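{- If $\alpha$ is a square-free positive rational number and $\mathcal T=(T,\nu)$ is a factorization tree for $\alpha$, then the content map $\nu:V(T)\to\mathfrak F_\alpha$ is injective.
   Context: Write $\alpha=a/b$ with $a,b$ coprime positive integers; $\alpha$ is square-free if $a$ and $b$ are both square-free. Let $p_1\ge\cdots\ge p_N$ be the primes dividing $ab$, listed with multiplicity. Put $\gamma(i)=1$ if $p_i\mid a$, $\gamma(i)=-1$ if $p_i\mid b$, and $\alpha_n=\prod_{i=1}^n p_i^{\gamma(i)}$ for $0\le n\le N$. A factorization of a positive rational $\beta$ is a sequence $(a_1/b_1,a_2/b_2,\dots)$ with $a_i,b_i$ positive integers, $a_i=b_i=1$ for all but finitely many $i$, $\prod_i a_i/b_i=\beta$, $\max\{a_i,b_i\}\ge\max\{a_{i+1},b_{i+1}\}$ for all $i$, and $\gcd(a_i,b_j)=1$ for all $i,j$. Let $\mathfrak F_\alpha$ be the set of factorizations of $\alpha_n$, $0\le n\le N$. For $0\le n<N$, a factorization $(a_i/b_i)$ of $\alpha_n$ is a direct subfactorization of a factorization $(c_i/d_i)$ of $\alpha_{n+1}$ if either $p_{n+1}\mid a$ and for some $k$: $d_i=b_i$ for all $i$, $c_i=a_i$ for $i\ne k$, $c_k=a_kp_{n+1}$; or $p_{n+1}\mid b$ and for some $k$: $c_i=a_i$ for all $i$, $d_i=b_i$ for $i\ne k$, $d_k=b_kp_{n+1}$. A factorization tree for $\alpha$ is a pair $(T,\nu)$ with $T$ a rooted tree (digraph with edges from each vertex to its children) and $\nu:V(T)\to\mathfrak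 F_\alpha$ (the content map), with parenting map $\phi$, such that: (1) the root $r_0$ has $\nu(r_0)=(1,1,\dots)$; (2) if $n<N$ and $\nu(r)$ is a factorization of $\alpha_n$ then $r$ has a child; (3) $\nu(r)=\nu(s)$ and $\phi(r)=\phi(s)$ imply $r=s$; (4) for non-root $r$, $\nu(\phi(r))$ is a direct subfactorization of $\nu(r)$. -}

module Defs where

open import Data.Nat using (ℕ; zero; suc; _*_; _≤_; _<_; _≥_; _⊔_)
open import Data.Nat.Divisibility using (_∣_; _∣?_)
open import Data.Nat.Coprimality using (Coprime)
open import Data.Nat.Primality using (Prime)
open import Data.Product using (Σ; ∃; ∃-syntax; _×_; _,_; proj₁; proj₂)
open import Data.Sum using (_⊎_)
open import Data.Maybe using (Maybe; just; nothing)
open import Data.Nat.ListAction using (product)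
open import Data.List using (List; []; _∷_; map; upTo; take; filter; length)
open import Data.List.Relation.Unary.All using (All)
open import Data.List.Relation.Unary.Linked using (Linked)
open import Relation.Binary.PropositionalEquality using (_≡_; _≢_)

SquareFree : ℕ → Set
SquareFree n = ∀ d → d * d ∣ n → d ≡ 1

-- The data attached to α = a / b.
-- ps is the list p₁ ≥ p₂ ≥ … ≥ p_N of primes dividing ab, with
-- multiplicity; it is characterised (uniquely, by unique factorisation)
-- by: all entries prime, non-increasing, and product ps ≡ a * b.

IsPrimeList : ℕ → ℕ → List ℕ → Set
IsPrimeList a b ps = All Prime ps × Linked _≥_ ps × product ps ≡ a * b

-- (n+1)-th entry (0-based index n) of a list; default 1 off the end
-- (only ever used with n < length).
at : List ℕ → ℕ → ℕ
at []       _       = 1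
at (x ∷ xs) zero    = x
at (x ∷ xs) (suc n) = at xs n

-- α_n = ∏_{i ≤ n} p_i^{γ(i)} = num a ps n / den b ps n, where γ(i) = 1
-- iff p_i ∣ a and γ(i) = -1 iff p_i ∣ b.
num : ℕ → List ℕ → ℕ → ℕ
num a ps n = product (filter (_∣? a) (take n ps))

den : ℕ → List ℕ → ℕ → ℕ
den b ps n = product (filter (_∣? b) (take n ps))

-- Sequences (a₁/b₁, a₂/b₂, …) of formal fractions, indexed from 0.
-- Entry i is the pair (aᵢ , bᵢ).  Two sequences are equal iff they are
-- pointwise equal.

Seq : Set
Seq = ℕ → ℕ × ℕ

nu : Seq → ℕ → ℕ
nu f i = proj₁ (f i)

de : Seq → ℕ → ℕ
de f i = proj₂ (f i)

_≐_ : Seq → Seq → Set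
f ≐ g = ∀ i → f i ≡ g i

prodBelow : ℕ → (ℕ → ℕ) → ℕ
prodBelow M g = product (map g (upTo M))

IsFactorization : Seq → ℕ → ℕ → Set
IsFactorization f A B =
    (∀ i → 1 ≤ nu f i × 1 ≤ de f i)
  × (∃[ M ] ((∀ i → M ≤ i → f i ≡ (1 , 1))
            × prodBelow M (nu f) * B ≡ prodBelow M (de f) * A))
  × (∀ i → nu f i ⊔ de f i ≥ nu f (suc i) ⊔ de f (suc i))
  × (∀ i j → Coprime (nu f i) (de f j))

IsFactOf : ℕ → ℕ → List ℕ → Seq → ℕ → Set
IsFactOf a b ps f n = IsFactorization f (num a ps n) (den b ps n)

InFα : ℕ → ℕ → List ℕ → Seq → Set
InFα a b ps f = ∃[ n ] (n ≤ length ps × IsFactOf a b ps f n)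

DirectSub : ℕ → ℕ → List ℕ → ℕ → Seq → Seq → Set
DirectSub a b ps n f g =
    n < length ps
  × IsFactOf a b ps f n
  × IsFactOf a b ps g (suc n)
  × ( (at ps n ∣ a × ∃[ k ] ( (∀ i → de g i ≡ de f i)
                            × (∀ i → i ≢ k → nu g i ≡ nu f i)
                            × nu g k ≡ nu f k * at ps n))
    ⊎ (at ps n ∣ b × ∃[ k ] ( (∀ i → nu g i ≡ nu f i)
                            × (∀ i → i ≢ k → de g i ≡ de f i)
                            × de g k ≡ de f k * at ps n)))

ancestor : {V : Set} → (V → Maybe V) → ℕ → V → Maybe V
ancestor φ zero    r = just r
ancestor φ (suc k) r with φ r
... | nothing = nothing
... | just s  = ancestor φ k s

record RootedTree : Set₁ where
  field
    V         : Set
    root      : V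
    parent    : V → Maybe V
    root-noParent : parent root ≡ nothing
    noParent→root : ∀ r → parent r ≡ nothing → r ≡ root
    reachesRoot   : ∀ r → ∃[ k ] (ancestor parent k r ≡ just root)

record FactorizationTree (a b : ℕ) (ps : List ℕ) : Set₁ where
  field
    tree : RootedTree
  open RootedTree tree public
  field
    content     : V → Seq
    content∈Fα  : ∀ r → InFα a b ps (content r)
    rootContent : content root ≐ (λ _ → (1 , 1))
    hasChild    : ∀ r n → n < length ps → IsFactOf a b ps (content r) n →
                  ∃[ s ] (parent s ≡ just r)
    separated   : ∀ r s → content r ≐ content s → parent r ≡ parent s → r ≡ s
    parentSub   : ∀ r q → parent r ≡ just q →
                  ∃[ n ] DirectSub a b ps n (content q) (content r)

module Submission where

-- The heart of the proof is that, for square-free α, a factorization g has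
-- at most one direct subfactorization.  Three facts give this:
--   * the value of a factorization is determined by the sequence, and the
--     values α₁, …, α_N are pairwise distinct (a nonempty run of primes of
--     ab never contributes equally to numerator and denominator, as
--     a ⊥ b); hence the level n with g a factorization of α_{n+1} is unique;
--   * the prime p = p_{n+1} divides exactly one of a, b, and it divides
--     α_{n+1}'s numerator (say) at most once since a is square-free; as the
--     entries of g are coprime, p therefore sits in exactly one entry;
--   * dividing that entry by p recovers the subfactorization.
-- The denominator case is the numerator case for the flipped sequence.
-- The theorem then follows by induction on the depth of a vertex: equal
-- contents force equal parent contents, hence equal parents, and then
-- condition (3) of factorization trees identifies the vertices.

open import Defs
open import Data.Nat using (ℕ; zero; suc; _+_; _*_; _≤_; _<_; _≟_; s≤s; s≤s⁻¹; NonZero; >-nonZero)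
open import Data.Nat.Properties
open import Algebra.Properties.CommutativeSemigroup *-commutativeSemigroup using (interchange; x∙yz≈y∙xz)
open import Data.Nat.Divisibility
open import Data.Nat.Coprimality using (Coprime)
import Data.Nat.Coprimality as Coprime
open import Data.Nat.Primality using (Prime; euclidsLemma; ¬prime[1]; prime⇒nonZero)
open import Data.Nat.ListAction using (product)
open import Data.Nat.ListAction.Properties using (product-++)
open import Data.List using (List; []; _∷_; _++_; [_]; map; upTo; take; drop; filter; length)
open import Data.List.Properties using (upTo-∷ʳ; map-++; filter-accept; filter-reject; take++drop≡id)
open import Data.List.Relation.Unary.All using (All; []; _∷_)
open import Data.Maybe using (Maybe; just; nothing)
open import Data.Maybe.Properties using (just-injective)
open import Data.Product using (∃-syntax; ∃₂; _×_; _,_; proj₁; proj₂)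
open import Data.Sum using (_⊎_; inj₁; inj₂)
open import Data.Empty using (⊥; ⊥-elim)
open import Relation.Nullary using (¬_; yes; no)
open import Relation.Binary using (tri<; tri≈; tri>)
open import Relation.Binary.PropositionalEquality hiding ([_])
open ≡-Reasoning

prime∤1 : ∀ {p} → Prime p → ¬ (p ∣ 1)
prime∤1 pp p∣1 = ¬prime[1] (subst Prime (∣1⇒≡1 p∣1) pp)

coprime⇒¬common : ∀ {p m n} → Coprime m n → Prime p → p ∣ m → p ∣ n → ⊥
coprime⇒¬common cop pp p∣m p∣n = ¬prime[1] (subst Prime (cop (p∣m , p∣n)) pp)

prime²-divisor : ∀ {p} → Prime p → ∀ Y A → ¬ (p ∣ Y) → p * p ∣ Y * A → p * p ∣ A
prime²-divisor {p} pp Y A p∤Y p²∣YA with euclidsLemma Y A pp (∣-trans (m∣m*n p) p²∣YA)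
... | inj₁ p∣Y = ⊥-elim (p∤Y p∣Y)
... | inj₂ (divides q refl) = *-pres-∣ p∣q (∣-refl {p})
  where
    instance _ = prime⇒nonZero pp
    p∣q : p ∣ q
    p∣q with euclidsLemma Y q pp (*-cancelʳ-∣ p (subst (p * p ∣_) (sym (*-assoc Y q p)) p²∣YA))
    ... | inj₁ p∣Y = ⊥-elim (p∤Y p∣Y)
    ... | inj₂ p∣q = p∣q

squareFree⇒¬p²∣ : ∀ {p a b} → Prime p → p ∣ a → Coprime a b → SquareFree a → ¬ (p * p ∣ a * b)
squareFree⇒¬p²∣ {p} {a} {b} pp p∣a cop sqa p²∣ab =
  ¬prime[1] (subst Prime (sqa p p²∣a) pp)
  where
    p²∣a : p * p ∣ a
    p²∣a = prime²-divisor pp b a (coprime⇒¬common cop pp p∣a) (subst (p * p ∣_) (*-comm a b) p²∣ab)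

∏< : ℕ → (ℕ → ℕ) → ℕ
∏< zero    h = 1
∏< (suc M) h = ∏< M h * h M

prodBelow≡∏< : ∀ M h → prodBelow M h ≡ ∏< M h
prodBelow≡∏< zero    h = refl
prodBelow≡∏< (suc M) h = begin
  product (map h (upTo (suc M)))     ≡⟨ cong (λ l → product (map h l)) (sym (upTo-∷ʳ M)) ⟩
  product (map h (upTo M ++ [ M ]))  ≡⟨ cong product (map-++ h (upTo M) [ M ]) ⟩
  product (map h (upTo M) ++ [ h M ]) ≡⟨ product-++ (map h (upTo M)) [ h M ] ⟩
  prodBelow M h * (h M * 1)          ≡⟨ cong₂ _*_ (prodBelow≡∏< M h) (*-identityʳ (h M)) ⟩
  ∏< M h * h M                       ∎

∏<-cong : ∀ M {h h'} → (∀ i → h i ≡ h' i) → ∏< M h ≡ ∏< M h'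
∏<-cong zero    e = refl
∏<-cong (suc M) e = cong₂ _*_ (∏<-cong M e) (e M)

∏<-support : ∀ M d h → (∀ i → M ≤ i → h i ≡ 1) → ∏< (d + M) h ≡ ∏< M h
∏<-support M zero    h one = refl
∏<-support M (suc d) h one = begin
  ∏< (d + M) h * h (d + M) ≡⟨ cong (∏< (d + M) h *_) (one (d + M) (m≤n+m M d)) ⟩
  ∏< (d + M) h * 1         ≡⟨ *-identityʳ _ ⟩
  ∏< (d + M) h             ≡⟨ ∏<-support M d h one ⟩
  ∏< M h                   ∎

∏<-positive : ∀ M h → (∀ i → 1 ≤ h i) → 1 ≤ ∏< M h
∏<-positive zero    h pos = ≤-refl
∏<-positive (suc M) h pos = *-mono-≤ {1} {_} {1} (∏<-positive M h pos) (pos M)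

∣∏< : ∀ M h k → k < M → h k ∣ ∏< M h
∣∏< (suc M) h k k<1+M with m≤n⇒m<n∨m≡n (s≤s⁻¹ k<1+M)
... | inj₁ k<M  = ∣-trans (∣∏< M h k k<M) (m∣m*n (h M))
... | inj₂ refl = n∣m*n (∏< M h)

∣∏<-pair : ∀ M h k k' → k < k' → k' < M → h k * h k' ∣ ∏< M h
∣∏<-pair (suc M) h k k' k<k' k'<1+M with m≤n⇒m<n∨m≡n (s≤s⁻¹ k'<1+M)
... | inj₁ k'<M = ∣-trans (∣∏<-pair M h k k' k<k' k'<M) (m∣m*n (h M))
... | inj₂ refl = *-pres-∣ (∣∏< M h k k<k') ∣-refl

prime∣∏< : ∀ {p} → Prime p → ∀ M h → p ∣ ∏< M h → ∃[ j ] (p ∣ h j)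
prime∣∏< pp zero    h p∣1 = ⊥-elim (prime∤1 pp p∣1)
prime∣∏< pp (suc M) h p∣∏ with euclidsLemma (∏< M h) (h M) pp p∣∏
... | inj₁ p∣∏' = prime∣∏< pp M h p∣∏'
... | inj₂ p∣hM = M , p∣hM

balanced : ∀ {g A B} → IsFactorization g A B →
           ∃[ M ] (∀ d → ∏< (d + M) (nu g) * B ≡ ∏< (d + M) (de g) * A)
balanced {g} {A} {B} (_ , (M , supp , eq) , _ , _) = M , λ d → begin
  ∏< (d + M) (nu g) * B  ≡⟨ cong (_* B) (∏<-support M d (nu g) (λ i le → cong proj₁ (supp i le))) ⟩
  ∏< M (nu g) * B        ≡⟨ cong (_* B) (sym (prodBelow≡∏< M (nu g))) ⟩
  prodBelow M (nu g) * B ≡⟨ eq ⟩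
  prodBelow M (de g) * A ≡⟨ cong (_* A) (prodBelow≡∏< M (de g)) ⟩
  ∏< M (de g) * A        ≡⟨ cong (_* A) (sym (∏<-support M d (de g) (λ i le → cong proj₂ (supp i le)))) ⟩
  ∏< (d + M) (de g) * A  ∎

cross-multiply : ∀ X Y A B A' B' → .{{NonZero X}} →
                 X * B ≡ Y * A → X * B' ≡ Y * A' → A * B' ≡ A' * B
cross-multiply X Y A B A' B' eq eq' = *-cancelˡ-≡ (A * B') (A' * B) X (begin
  X * (A * B')  ≡⟨ x∙yz≈y∙xz X A B' ⟩
  A * (X * B')  ≡⟨ cong (A *_) eq' ⟩
  A * (Y * A')  ≡⟨ x∙yz≈y∙xz A Y A' ⟩
  Y * (A * A')  ≡⟨ cong (Y *_) (*-comm A A') ⟩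
  Y * (A' * A)  ≡⟨ x∙yz≈y∙xz Y A' A ⟩
  A' * (Y * A)  ≡⟨ cong (A' *_) (sym eq) ⟩
  A' * (X * B)  ≡⟨ x∙yz≈y∙xz A' X B ⟩
  X * (A' * B)  ∎)

factorization-value : ∀ {g g' A B A' B'} → IsFactorization g A B → IsFactorization g' A' B' →
                      g ≐ g' → A * B' ≡ A' * B
factorization-value {g} {g'} {A} {B} {A'} {B'} fac@(pos , _) fac' g≐g' =
  cross-multiply (∏< L (nu g)) (∏< L (de g)) A B A' B' {{nonZero}} (eq M') eq'
  where
    M  = proj₁ (balanced fac)
    eq = proj₂ (balanced fac)
    M' = proj₁ (balanced fac')
    L  = M' + M
    nonZero : NonZero (∏< L (nu g))
    nonZero = >-nonZero (∏<-positive L (nu g) (λ i → proj₁ (pos i)))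
    eq' : ∏< L (nu g) * B' ≡ ∏< L (de g) * A'
    eq' = begin
      ∏< L (nu g) * B'         ≡⟨ cong (λ t → ∏< t (nu g) * B') (+-comm M' M) ⟩
      ∏< (M + M') (nu g) * B'  ≡⟨ cong (_* B') (∏<-cong (M + M') (λ i → cong proj₁ (g≐g' i))) ⟩
      ∏< (M + M') (nu g') * B' ≡⟨ proj₂ (balanced fac') M ⟩
      ∏< (M + M') (de g') * A' ≡⟨ cong (_* A') (∏<-cong (M + M') (λ i → cong proj₂ (sym (g≐g' i)))) ⟩
      ∏< (M + M') (de g) * A'  ≡⟨ cong (λ t → ∏< t (de g) * A') (+-comm M M') ⟩
      ∏< L (de g) * A'         ∎

-- If a prime divides two distinct numerators of a factorization of A/B,
-- its square divides A (numerators are coprime to all denominators).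
prime-in-two-numerators : ∀ {g A B p k k'} → IsFactorization g A B → Prime p →
                          p ∣ nu g k → p ∣ nu g k' → k ≢ k' → p * p ∣ A
prime-in-two-numerators {g} {A} {B} {p} {k} {k'} fac@(_ , _ , _ , cop) pp p∣k p∣k' k≢k' =
  prime²-divisor pp (∏< L (de g)) A p∤∏de (subst (p * p ∣_) (proj₂ (balanced fac) d) p²∣∏nu*B)
  where
    d = suc k + suc k'
    L = d + proj₁ (balanced fac)
    k<L : k < L
    k<L = ≤-trans (m≤m+n (suc k) (suc k')) (m≤m+n d _)
    k'<L : k' < L
    k'<L = ≤-trans (m≤n+m (suc k') (suc k)) (m≤m+n d _)
    p²∣∏nu : p * p ∣ ∏< L (nu g)
    p²∣∏nu with <-cmp k k'
    ... | tri< k<k' _ _ = ∣-trans (*-pres-∣ p∣k p∣k') (∣∏<-pair L (nu g) k k' k<k' k'<L)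
    ... | tri≈ _ k≡k' _ = ⊥-elim (k≢k' k≡k')
    ... | tri> _ _ k>k' = ∣-trans (*-pres-∣ p∣k' p∣k) (∣∏<-pair L (nu g) k' k k>k' k<L)
    p²∣∏nu*B : p * p ∣ ∏< L (nu g) * B
    p²∣∏nu*B = ∣-trans p²∣∏nu (m∣m*n B)
    p∤∏de : ¬ (p ∣ ∏< L (de g))
    p∤∏de p∣∏ with prime∣∏< pp L (de g) p∣∏
    ... | j , p∣j = coprime⇒¬common (cop k j) pp p∣k p∣j

NumStep : ℕ → ℕ → Seq → Seq → Set
NumStep p k f g = (∀ i → de g i ≡ de f i) × (∀ i → i ≢ k → nu g i ≡ nu f i) × nu g k ≡ nu f k * p

numStep-cancel : ∀ {p k f f' g g'} → .{{NonZero p}} → g ≐ g' →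
                 NumStep p k f g → NumStep p k f' g' → f ≐ f'
numStep-cancel {p} {k} {f} {f'} g≐g' (de≡ , nu≡ , nuₖ≡) (de≡' , nu≡' , nuₖ≡') i =
  cong₂ _,_ numerator (trans (sym (de≡ i)) (trans (cong proj₂ (g≐g' i)) (de≡' i)))
  where
    numerator : nu f i ≡ nu f' i
    numerator with i ≟ k
    ... | yes refl = *-cancelʳ-≡ _ _ p (trans (sym nuₖ≡) (trans (cong proj₁ (g≐g' i)) nuₖ≡'))
    ... | no  i≢k  = trans (sym (nu≡ i i≢k)) (trans (cong proj₁ (g≐g' i)) (nu≡' i i≢k))

-- If p² ∤ A, a factorization of A/B arises from at most one f by a p-step:
-- both steps must hit the one numerator that p divides.
numStep-unique : ∀ {p k k' f f' g g' A B} → IsFactorization g A B → Prime p → ¬ (p * p ∣ A) →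
                 g ≐ g' → NumStep p k f g → NumStep p k' f' g' → f ≐ f'
numStep-unique {p} {k} {k'} {f} {f'} {g} fac pp p²∤A g≐g' step@(_ , _ , nuₖ≡) step'@(_ , _ , nuₖ'≡)
  with k ≟ k'
... | yes refl = numStep-cancel {{prime⇒nonZero pp}} g≐g' step step'
... | no k≢k'  = ⊥-elim (p²∤A (prime-in-two-numerators fac pp p∣k p∣k' k≢k'))
  where
    p∣k : p ∣ nu g k
    p∣k = subst (p ∣_) (sym nuₖ≡) (n∣m*n (nu f k))
    p∣k' : p ∣ nu g k'
    p∣k' = subst (p ∣_) (sym (trans (cong proj₁ (g≐g' k')) nuₖ'≡)) (n∣m*n (nu f' k'))

numStep-nontrivial : ∀ {p k f g} → Prime p → NumStep p k f g → nu g k ≢ 1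
numStep-nontrivial {p} {k} {f} pp (_ , _ , nuₖ≡) nuₖ≡1 =
  ¬prime[1] (subst Prime (m*n≡1⇒n≡1 (nu f k) p (trans (sym nuₖ≡) nuₖ≡1)) pp)

-- Reading a sequence upside down exchanges numerators and denominators;
-- this reduces every statement about denominators to one about numerators.
flipSeq : Seq → Seq
flipSeq g i = de g i , nu g i

flip-≐ : ∀ {f f'} → f ≐ f' → flipSeq f ≐ flipSeq f'
flip-≐ e i = cong₂ _,_ (cong proj₂ (e i)) (cong proj₁ (e i))

unflip-≐ : ∀ {f f'} → flipSeq f ≐ flipSeq f' → f ≐ f'
unflip-≐ e i = cong₂ _,_ (cong proj₂ (e i)) (cong proj₁ (e i))

flip-factorization : ∀ {g A B} → IsFactorization g A B → IsFactorization (flipSeq g) B A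
flip-factorization {g} (pos , (M , supp , eq) , mono , cop) =
    (λ i → proj₂ (pos i) , proj₁ (pos i))
  , (M , (λ i le → cong (λ x → proj₂ x , proj₁ x) (supp i le)) , sym eq)
  , (λ i → subst₂ _≤_ (⊔-comm (nu g (suc i)) (de g (suc i))) (⊔-comm (nu g i) (de g i)) (mono i))
  , (λ i j → Coprime.sym (cop j i))

-- The product of those entries of ys dividing c (the c-part of ys);
-- by definition num a ps n ≡ part a (take n ps) and den b ps n ≡ part b (take n ps).
part : ℕ → List ℕ → ℕ
part c ys = product (filter (_∣? c) ys)

part∣product : ∀ c ys → part c ys ∣ product ys
part∣product c []       = ∣-refl
part∣product c (y ∷ ys) with y ∣? c
... | yes _ = *-monoʳ-∣ y (part∣product c ys)
... | no  _ = ∣-trans (part∣product c ys) (n∣m*n y)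

prefix-part∣ : ∀ c n ps → part c (take n ps) ∣ product ps
prefix-part∣ c n ps = ∣-trans (part∣product c (take n ps)) (subst (product (take n ps) ∣_) take++drop (m∣m*n _))
  where
    take++drop : product (take n ps) * product (drop n ps) ≡ product ps
    take++drop = trans (sym (product-++ (take n ps) (drop n ps))) (cong product (take++drop≡id n ps))

prime∣part : ∀ {x} c → Prime x → ∀ ys → x ∣ part c ys → x ∣ c
prime∣part c px []       x∣1 = ⊥-elim (prime∤1 px x∣1)
prime∣part c px (y ∷ ys) x∣part with y ∣? c
... | no  _ = prime∣part c px ys x∣part
... | yes y∣c with euclidsLemma y (part c ys) px x∣part
...   | inj₁ x∣y = ∣-trans x∣y y∣c
...   | inj₂ x∣rest = prime∣part c px ys x∣rest

Side : ℕ → ℕ → ℕ → Set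
Side a b x = Prime x × (x ∣ a ⊎ x ∣ b)

sides : ∀ {a b xs} → All Prime xs → product xs ∣ a * b → All (Side a b) xs
sides {xs = []}     []          _   = []
sides {a} {b} {x ∷ xs} (px ∷ pxs) ∏∣ab =
  (px , euclidsLemma a b px (∣-trans (m∣m*n (product xs)) ∏∣ab)) ∷ sides pxs (∣-trans (n∣m*n x) ∏∣ab)

head-split : ∀ {a b x} → Coprime a b → Side a b x →
             ∃₂ λ c d → c * d ≡ x × ∀ ys → part a (x ∷ ys) ≡ c * part a ys × part b (x ∷ ys) ≡ d * part b ys
head-split {a} {b} {x} cop (px , inj₁ x∣a) = x , 1 , *-identityʳ x , λ ys →
    cong product (filter-accept (_∣? a) x∣a)
  , trans (cong product (filter-reject (_∣? b) (coprime⇒¬common cop px x∣a))) (sym (*-identityˡ _))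
head-split {a} {b} {x} cop (px , inj₂ x∣b) = 1 , x , *-identityˡ x , λ ys →
    trans (cong product (filter-reject (_∣? a) (λ x∣a → coprime⇒¬common cop px x∣a x∣b))) (sym (*-identityˡ _))
  , cong product (filter-accept (_∣? b) x∣b)

cancel-head : ∀ {a b x} → Coprime a b → Side a b x → ∀ u v →
              part a (x ∷ u) * part b (x ∷ v) ≡ part a (x ∷ v) * part b (x ∷ u) →
              part a u * part b v ≡ part a v * part b u
cancel-head {a} {b} {x} cop side@(px , _) u v eq with head-split cop side
... | c , d , cd≡x , split =
  *-cancelˡ-≡ _ _ (c * d) {{subst NonZero (sym cd≡x) (prime⇒nonZero px)}} (begin
    (c * d) * (part a u * part b v)         ≡⟨ interchange c d _ _ ⟩
    (c * part a u) * (d * part b v)         ≡⟨ sym (cong₂ _*_ (proj₁ (split u)) (proj₂ (split v))) ⟩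
    part a (x ∷ u) * part b (x ∷ v)         ≡⟨ eq ⟩
    part a (x ∷ v) * part b (x ∷ u)         ≡⟨ cong₂ _*_ (proj₁ (split v)) (proj₂ (split u)) ⟩
    (c * part a v) * (d * part b u)         ≡⟨ interchange c _ d _ ⟩
    (c * d) * (part a v * part b u)         ∎)

unbalanced : ∀ {a b x} → Coprime a b → Side a b x → ∀ ys → part a (x ∷ ys) ≢ part b (x ∷ ys)
unbalanced {a} {b} {x} cop (px , inj₁ x∣a) ys eq =
  coprime⇒¬common cop px x∣a (prime∣part b px (x ∷ ys) (subst (x ∣_) eq x∣part))
  where x∣part = subst (x ∣_) (sym (cong product (filter-accept (_∣? a) x∣a))) (m∣m*n _)
unbalanced {a} {b} {x} cop (px , inj₂ x∣b) ys eq =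
  coprime⇒¬common cop px (prime∣part a px (x ∷ ys) (subst (x ∣_) (sym eq) x∣part)) x∣b
  where x∣part = subst (x ∣_) (sym (cong product (filter-accept (_∣? b) x∣b))) (m∣m*n _)

distinct-levels : ∀ {a b} → Coprime a b → ∀ {xs} → All (Side a b) xs → ∀ {j j'} → j < j' → j' ≤ length xs →
                  part a (take j xs) * part b (take j' xs) ≢ part a (take j' xs) * part b (take j xs)
distinct-levels {a} {b} cop {x ∷ xs} (side ∷ _) {zero} {suc i} _ _ eq =
  unbalanced cop side (take i xs) (begin
    part a (x ∷ take i xs)     ≡⟨ sym (*-identityʳ _) ⟩
    part a (x ∷ take i xs) * 1 ≡⟨ sym eq ⟩
    1 * part b (x ∷ take i xs) ≡⟨ *-identityˡ _ ⟩
    part b (x ∷ take i xs)     ∎)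
distinct-levels cop {x ∷ xs} (side ∷ rest) {suc j} {suc j'} j<j' j'≤N eq =
  distinct-levels cop rest (s≤s⁻¹ j<j') (s≤s⁻¹ j'≤N) (cancel-head cop side (take j xs) (take j' xs) eq)

same-level : ∀ {a b ps} → Coprime a b → All (Side a b) ps → ∀ {n m} → n < length ps → m < length ps →
             num a ps (suc n) * den b ps (suc m) ≡ num a ps (suc m) * den b ps (suc n) → n ≡ m
same-level cop all-sides {n} {m} n<N m<N eq with <-cmp n m
... | tri< n<m _ _ = ⊥-elim (distinct-levels cop all-sides (s≤s n<m) m<N eq)
... | tri≈ _ n≡m _ = n≡m
... | tri> _ _ n>m = ⊥-elim (distinct-levels cop all-sides (s≤s n>m) n<N (sym eq))

at-all : ∀ {Q : ℕ → Set} xs n → All Q xs → n < length xs → Q (at xs n)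
at-all (x ∷ xs) zero    (q ∷ _)  _   = q
at-all (x ∷ xs) (suc n) (_ ∷ qs) n<N = at-all xs n qs (s≤s⁻¹ n<N)

directSub-nontrivial : ∀ {a b ps n f g} → All Prime ps → DirectSub a b ps n f g → ¬ (g ≐ λ _ → (1 , 1))
directSub-nontrivial {ps = ps} {n} aps (n<N , _ , _ , inj₁ (_ , k , step)) g≐1 =
  numStep-nontrivial (at-all ps n aps n<N) step (cong proj₁ (g≐1 k))
directSub-nontrivial {ps = ps} {n} aps (n<N , _ , _ , inj₂ (_ , k , step)) g≐1 =
  numStep-nontrivial {f = flipSeq _} {g = flipSeq _} (at-all ps n aps n<N) step (cong proj₂ (g≐1 k))

prefix-no-p² : ∀ {c d p} ps n → Prime p → p ∣ c → Coprime c d → SquareFree c → product ps ≡ c * d →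
               ¬ (p * p ∣ part c (take n ps))
prefix-no-p² {c} ps n pp p∣c cop sqc prod p²∣ =
  squareFree⇒¬p²∣ pp p∣c cop sqc (∣-trans p²∣ (subst (part c (take n ps) ∣_) prod (prefix-part∣ c n ps)))

directSub-unique : ∀ {a b ps n m f f' g g'} → Coprime a b → SquareFree a → SquareFree b →
                   IsPrimeList a b ps → g ≐ g' →
                   DirectSub a b ps n f g → DirectSub a b ps m f' g' → f ≐ f'
directSub-unique {a} {b} {ps} {n} cop sqa sqb (aps , _ , prod) g≐g' (n<N , _ , fac , sub) (m<N , _ , fac' , sub')
  with same-level cop (sides aps (subst (product ps ∣_) prod ∣-refl)) n<N m<N (factorization-value fac fac' g≐g')
     | at-all ps n aps n<N
... | refl | pp with sub | sub'
...   | inj₁ (p∣a , _ , step) | inj₁ (_ , _ , step') =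
          numStep-unique fac pp (prefix-no-p² ps (suc n) pp p∣a cop sqa prod) g≐g' step step'
...   | inj₂ (p∣b , _ , step) | inj₂ (_ , _ , step') =
          unflip-≐ (numStep-unique (flip-factorization fac) pp
                      (prefix-no-p² ps (suc n) pp p∣b (Coprime.sym cop) sqb (trans prod (*-comm a b)))
                      (flip-≐ g≐g') step step')
...   | inj₁ (p∣a , _) | inj₂ (p∣b , _) = ⊥-elim (coprime⇒¬common cop pp p∣a p∣b)
...   | inj₂ (p∣b , _) | inj₁ (p∣a , _) = ⊥-elim (coprime⇒¬common cop pp p∣a p∣b)

ancestor-step : ∀ {V : Set} (φ : V → Maybe V) k r q → φ r ≡ just q → ancestor φ (suc k) r ≡ ancestor φ k q
ancestor-step φ k r q eq with φ r
ancestor-step φ k r q refl | just .q = refl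

module _ {a b ps} (𝒯 : FactorizationTree a b ps) where
  open FactorizationTree 𝒯

  root-or-child : ∀ r → r ≡ root ⊎ ∃[ q ] (parent r ≡ just q)
  root-or-child r with parent r in eq
  ... | nothing = inj₁ (noParent→root r eq)
  ... | just q  = inj₂ (q , refl)

  parent-depth : ∀ {r q} k → parent r ≡ just q → ancestor parent k r ≡ just root →
                 ∃[ k' ] (k ≡ suc k' × ancestor parent k' q ≡ just root)
  parent-depth zero pr anc with just-injective anc
  ... | refl = ⊥-elim (just≢nothing (trans (sym pr) root-noParent))
    where just≢nothing : ∀ {x : V} → just x ≢ nothing
          just≢nothing ()
  parent-depth {r} {q} (suc k) pr anc = k , refl , trans (sym (ancestor-step parent k r q pr)) anc

  content-injective :
    (∀ {r s q q'} → parent r ≡ just q → parent s ≡ just q' → content r ≐ content s → content q ≐ content q') →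
    (∀ {s q} → parent s ≡ just q → ¬ (content s ≐ content root)) →
    ∀ r s → content r ≐ content s → r ≡ s
  content-injective parents-agree child≠root r s = by-depth (proj₁ (reachesRoot r)) r (proj₂ (reachesRoot r)) s
    where
      by-depth : ∀ k r → ancestor parent k r ≡ just root → ∀ s → content r ≐ content s → r ≡ s
      by-depth k r anc s e with root-or-child r | root-or-child s
      ... | inj₁ refl      | inj₁ refl       = refl
      ... | inj₁ refl      | inj₂ (_ , s→q)   = ⊥-elim (child≠root s→q (λ i → sym (e i)))
      ... | inj₂ (_ , r→q) | inj₁ refl        = ⊥-elim (child≠root r→q e)
      ... | inj₂ (q , r→q) | inj₂ (q' , s→q') with parent-depth k r→q anc
      ...   | k' , refl , anc' =
                separated r s e (trans r→q (trans (cong just q≡q') (sym s→q')))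
        where q≡q' : q ≡ q'
              q≡q' = by-depth k' q anc' q' (parents-agree r→q s→q' e)

lemma3p2 : (a b : ℕ) → 1 ≤ a → 1 ≤ b → Coprime a b →
    SquareFree a → SquareFree b →
    (ps : List ℕ) → IsPrimeList a b ps →
    (𝒯 : FactorizationTree a b ps) →
    let open FactorizationTree 𝒯 in
    ∀ r s → content r ≐ content s → r ≡ s
lemma3p2 a b _ _ cop sqa sqb ps primeList 𝒯 = content-injective 𝒯 parents-agree child≠root
  where
    open FactorizationTree 𝒯
    parents-agree : ∀ {r s q q'} → parent r ≡ just q → parent s ≡ just q' →
                    content r ≐ content s → content q ≐ content q'
    parents-agree r→q s→q' e with parentSub _ _ r→q | parentSub _ _ s→q'
    ... | _ , sub | _ , sub' = directSub-unique cop sqa sqb primeList e sub sub'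
    child≠root : ∀ {s q} → parent s ≡ just q → ¬ (content s ≐ content root)
    child≠root s→q e with parentSub _ _ s→q
    ... | _ , sub = directSub-nontrivial (proj₁ primeList) sub (λ i → trans (e i) (rootContent i))
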